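{- Let $\tau\in\{254613,524361,546132\}$, let $\beta=\beta_1\cdots\beta_m\in\operatorname{Av}(2143,3142,\tau)$, and let $i$ be an integer with $0\le i\le \ell(\beta)$. Then the permutation $$1\ominus_i\beta=\beta_1\cdots\beta_i\,(m+1)\,\beta_{i+1}\cdots\beta_m$$ of length $m+1$ belongs to $\operatorname{Av}(2143,3142,\tau)$.
   Context: $\operatorname{Av}(T)$ is the set of permutations avoiding every pattern in $T$. For a permutation $\pi$, an index $i$ is an LR-maximum if $\pi_j<\pi_i$ for all $j<i$; an index $i$ is a leading maximum if every index in $\{1,\dots,i\}$ is an LR-maximum (equivalently $\pi_1<\pi_2<\cdots<\pi_i$). $\ell(\pi)$ denotes the number of leading maxima of $\pi$ ($\ell$ of the empty permutation is $0$). The permutation $1\ominus_i\beta$ is obtained from the skew sum $1\ominus\beta$ (a new largest entry placed before $\beta$) by moving the first $i$ entries of $\beta$ (its first $i$ leading maxima) to the left of the new largest entry, keeping their values. -}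

module Defs where

open import Data.Nat using (ℕ; zero; suc; _<_; _≤_; _<?_)
open import Relation.Nullary using (yes; no)
open import Data.Empty using (⊥)
open import Data.List using (List; []; _∷_; length; map; upTo; take; drop; _++_; lookup)
open import Data.List.Relation.Binary.Permutation.Propositional using (_↭_)
open import Data.List.Relation.Binary.Sublist.Propositional using (_⊆_)
open import Data.Fin using (Fin)
open import Data.Product using (Σ; _×_; ∃; ∃-syntax)
open import Relation.Binary.PropositionalEquality using (_≡_; subst)
open import Function.Bundles using (_⇔_)

-- A permutation of length m is written in one-line notation as a list
-- of the values 1..m, each occurring exactly once.
IsPerm : ℕ → List ℕ → Set
IsPerm m π = π ↭ map suc (upTo m)

OrderIso : List ℕ → List ℕ → Set
OrderIso xs ys =
  Σ (length xs ≡ length ys) λ eq →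
    (a b : Fin (length xs)) →
      (lookup xs a < lookup xs b) ⇔
      (lookup ys (subst Fin eq a) < lookup ys (subst Fin eq b))

Contains : List ℕ → List ℕ → Set
Contains π p = ∃[ s ] (s ⊆ π × OrderIso s p)

Avoids : List ℕ → List ℕ → Set
Avoids π p = Contains π p → ⊥

InAv3 : List ℕ → ℕ → List ℕ → Set
InAv3 τ m π =
  IsPerm m π × Avoids π (2 ∷ 1 ∷ 4 ∷ 3 ∷ []) × Avoids π (3 ∷ 1 ∷ 4 ∷ 2 ∷ []) × Avoids π τ

-- number of leading maxima: length of the maximal strictly increasing prefix
-- (ℓ of the empty permutation is 0).
leadAux : ℕ → List ℕ → ℕ
leadAux prev [] = 0
leadAux prev (x ∷ xs) with prev <? x
... | yes _ = suc (leadAux x xs)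
... | no _ = 0

ℓ : List ℕ → ℕ
ℓ [] = 0
ℓ (x ∷ xs) = suc (leadAux x xs)

skewIns : ℕ → ℕ → List ℕ → List ℕ
skewIns i m β = take i β ++ (suc m ∷ drop i β)

τ₁ τ₂ τ₃ : List ℕ
τ₁ = 2 ∷ 5 ∷ 4 ∷ 6 ∷ 1 ∷ 3 ∷ []
τ₂ = 5 ∷ 2 ∷ 4 ∷ 3 ∷ 6 ∷ 1 ∷ []
τ₃ = 5 ∷ 4 ∷ 6 ∷ 1 ∷ 3 ∷ 2 ∷ []

module Submission where

-- An occurrence of a pattern in 1 ⊖ᵢ β either misses the new entry m+1, and is then
-- an occurrence in β, or uses it. In the latter case m+1 must play the role of the
-- pattern's maximum, and the entries of the occurrence to its left lie among the
-- first i entries of β, which increase because i ≤ ℓ(β). Each of 2143, 3142 and the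
-- three τ has a descent to the left of its maximum, so the second case is impossible.

open import Defs
open import Data.Nat using (ℕ; suc; zero; _≤_; _<_; _<?_; s≤s)
open import Data.Nat.Properties using (<-trans; <-asym; <⇒≱; m≤n⇒m≤1+n; ≤-pred)
open import Data.List using (List; []; _∷_; _++_; [_]; take; drop; map; upTo)
open import Data.List.Properties using (take++drop≡id; map-++; upTo-∷ʳ)
open import Data.List.Relation.Unary.All using (All; []; _∷_)
open import Data.List.Relation.Unary.All.Properties using (map⁺; all-upTo; take⁺; drop⁺)
open import Data.List.Relation.Unary.AllPairs using (AllPairs; []; _∷_)
open import Data.List.Relation.Unary.Linked using (Linked; [-]; _∷_)
open import Data.List.Relation.Unary.Linked.Properties using (Linked⇒AllPairs)
open import Data.List.Relation.Binary.Sublist.Propositional using (_⊆_; []; _∷_; _∷ʳ_)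
open import Data.List.Relation.Binary.Sublist.Propositional.Properties using (All-resp-⊆)
open import Data.List.Relation.Binary.Permutation.Propositional
  using (↭-sym; prep; module PermutationReasoning)
open import Data.List.Relation.Binary.Permutation.Propositional.Properties
  using (All-resp-↭; shift; ∷↭∷ʳ)
open import Data.Sum using (_⊎_; inj₁; inj₂)
open import Data.Product using (_×_; _,_; ∃₂)
open import Data.Fin using (#_)
open import Relation.Nullary using (¬_; yes)
open import Relation.Nullary.Decidable using (True; toWitness)
open import Relation.Binary.PropositionalEquality using (_≡_; refl; cong; sym; trans)
open import Function.Bundles using (module Equivalence)

open Equivalence using (from)

Increasing : List ℕ → Set
Increasing = AllPairs _<_

AllPairs-resp-⊆ : ∀ {a r} {A : Set a} {R : A → A → Set r} {s xs} →
                  s ⊆ xs → AllPairs R xs → AllPairs R s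
AllPairs-resp-⊆ []         []         = []
AllPairs-resp-⊆ (_ ∷ʳ s⊆xs) (_ ∷ Rxs) = AllPairs-resp-⊆ s⊆xs Rxs
AllPairs-resp-⊆ (refl ∷ s⊆xs) (Rx ∷ Rxs) = All-resp-⊆ s⊆xs Rx ∷ AllPairs-resp-⊆ s⊆xs Rxs

⊆-++-∷⁻ : ∀ {a} {A : Set a} {v : A} xs ys {s} → s ⊆ xs ++ v ∷ ys →
          s ⊆ xs ++ ys ⊎ ∃₂ λ s₁ s₂ → s ≡ s₁ ++ v ∷ s₂ × s₁ ⊆ xs × s₂ ⊆ ys
⊆-++-∷⁻ []       ys (_ ∷ʳ s⊆ys) = inj₁ s⊆ys
⊆-++-∷⁻ []       ys (refl ∷ s⊆ys) = inj₂ ([] , _ , refl , [] , s⊆ys)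
⊆-++-∷⁻ (x ∷ xs) ys (.x ∷ʳ s⊆) with ⊆-++-∷⁻ xs ys s⊆
... | inj₁ s⊆xs++ys = inj₁ (x ∷ʳ s⊆xs++ys)
... | inj₂ (s₁ , s₂ , eq , s₁⊆xs , s₂⊆ys) = inj₂ (s₁ , s₂ , eq , x ∷ʳ s₁⊆xs , s₂⊆ys)
⊆-++-∷⁻ (x ∷ xs) ys (refl ∷ s⊆) with ⊆-++-∷⁻ xs ys s⊆
... | inj₁ s⊆xs++ys = inj₁ (refl ∷ s⊆xs++ys)
... | inj₂ (s₁ , s₂ , eq , s₁⊆xs , s₂⊆ys) =
  inj₂ (x ∷ s₁ , s₂ , cong (x ∷_) eq , refl ∷ s₁⊆xs , s₂⊆ys)

leadAux-increasing : ∀ prev xs i → i ≤ leadAux prev xs → Linked _<_ (prev ∷ take i xs)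
leadAux-increasing prev xs       zero    _ = [-]
leadAux-increasing prev (x ∷ xs) (suc i) i≤ with prev <? x
... | yes prev<x = prev<x ∷ leadAux-increasing x xs i (≤-pred i≤)

take-ℓ-increasing : ∀ β i → i ≤ ℓ β → Increasing (take i β)
take-ℓ-increasing β        zero    _        = []
take-ℓ-increasing (x ∷ xs) (suc i) (s≤s i≤) = Linked⇒AllPairs <-trans (leadAux-increasing x xs i i≤)

IsPerm-bounded : ∀ {m π} → IsPerm m π → All (_≤ m) π
IsPerm-bounded {m} π↭ = All-resp-↭ (↭-sym π↭) (map⁺ (all-upTo m))

skewIns-IsPerm : ∀ m β i → IsPerm m β → IsPerm (suc m) (skewIns i m β)
skewIns-IsPerm m β i β↭ = begin
  take i β ++ suc m ∷ drop i β  ↭⟨ shift (suc m) (take i β) (drop i β) ⟩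
  suc m ∷ take i β ++ drop i β  ≡⟨ cong (suc m ∷_) (take++drop≡id i β) ⟩
  suc m ∷ β                     ↭⟨ prep (suc m) β↭ ⟩
  suc m ∷ map suc (upTo m)      ↭⟨ ∷↭∷ʳ (suc m) (map suc (upTo m)) ⟩
  map suc (upTo m) ++ [ suc m ] ≡⟨ trans (sym (map-++ suc (upTo m) _)) (cong (map suc) (upTo-∷ʳ m)) ⟩
  map suc (upTo (suc m))        ∎
  where open PermutationReasoning

<-lit : ∀ {a b} {a<b : True (a <? b)} → a < b
<-lit {a<b = a<b} = toWitness a<b

module _ (m : ℕ) where

  NoTopOccurrence : List ℕ → Set
  NoTopOccurrence p = ∀ s₁ s₂ → Increasing s₁ → All (_≤ m) s₁ → All (_≤ m) s₂ →
                      ¬ OrderIso (s₁ ++ suc m ∷ s₂) p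

  top-maximal : ∀ {x} → x ≤ m → ¬ suc m < x
  top-maximal x≤m m<x = <⇒≱ m<x (m≤n⇒m≤1+n x≤m)

  -- Case split on the position k of m+1: either the pattern has an entry larger than
  -- its k-th one, whose image would exceed m+1, or it has a descent before position k,
  -- contradicting the increase of s₁.

  no-top-2143 : NoTopOccurrence (2 ∷ 1 ∷ 4 ∷ 3 ∷ [])
  no-top-2143 [] (_ ∷ _ ∷ _ ∷ []) _ _ (_ ∷ y≤ ∷ _) (refl , iso) = top-maximal y≤ (from (iso (# 0) (# 2)) <-lit)
  no-top-2143 (_ ∷ []) (_ ∷ _ ∷ []) _ _ (y≤ ∷ _) (refl , iso) = top-maximal y≤ (from (iso (# 1) (# 2)) <-lit)
  no-top-2143 (_ ∷ _ ∷ []) (_ ∷ []) ((x<y ∷ _) ∷ _) _ _ (refl , iso) = <-asym x<y (from (iso (# 1) (# 0)) <-lit)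
  no-top-2143 (_ ∷ _ ∷ _ ∷ []) [] _ (_ ∷ _ ∷ x≤ ∷ _) _ (refl , iso) = top-maximal x≤ (from (iso (# 3) (# 2)) <-lit)
  no-top-2143 (_ ∷ _ ∷ _ ∷ _ ∷ []) _ _ _ _ (() , _)
  no-top-2143 (_ ∷ _ ∷ _ ∷ _ ∷ _ ∷ _) _ _ _ _ (() , _)

  no-top-3142 : NoTopOccurrence (3 ∷ 1 ∷ 4 ∷ 2 ∷ [])
  no-top-3142 [] (_ ∷ _ ∷ _ ∷ []) _ _ (_ ∷ y≤ ∷ _) (refl , iso) = top-maximal y≤ (from (iso (# 0) (# 2)) <-lit)
  no-top-3142 (_ ∷ []) (_ ∷ _ ∷ []) _ _ (y≤ ∷ _) (refl , iso) = top-maximal y≤ (from (iso (# 1) (# 2)) <-lit)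
  no-top-3142 (_ ∷ _ ∷ []) (_ ∷ []) ((x<y ∷ _) ∷ _) _ _ (refl , iso) = <-asym x<y (from (iso (# 1) (# 0)) <-lit)
  no-top-3142 (_ ∷ _ ∷ _ ∷ []) [] _ (_ ∷ _ ∷ x≤ ∷ _) _ (refl , iso) = top-maximal x≤ (from (iso (# 3) (# 2)) <-lit)
  no-top-3142 (_ ∷ _ ∷ _ ∷ _ ∷ []) _ _ _ _ (() , _)
  no-top-3142 (_ ∷ _ ∷ _ ∷ _ ∷ _ ∷ _) _ _ _ _ (() , _)

  no-top-τ₁ : NoTopOccurrence τ₁
  no-top-τ₁ [] (_ ∷ _ ∷ _ ∷ _ ∷ _ ∷ []) _ _ (_ ∷ _ ∷ y≤ ∷ _) (refl , iso) = top-maximal y≤ (from (iso (# 0) (# 3)) <-lit)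
  no-top-τ₁ (_ ∷ []) (_ ∷ _ ∷ _ ∷ _ ∷ []) _ _ (_ ∷ y≤ ∷ _) (refl , iso) = top-maximal y≤ (from (iso (# 1) (# 3)) <-lit)
  no-top-τ₁ (_ ∷ _ ∷ []) (_ ∷ _ ∷ _ ∷ []) _ _ (y≤ ∷ _) (refl , iso) = top-maximal y≤ (from (iso (# 2) (# 3)) <-lit)
  no-top-τ₁ (_ ∷ _ ∷ _ ∷ []) (_ ∷ _ ∷ []) (_ ∷ (x<y ∷ _) ∷ _) _ _ (refl , iso) = <-asym x<y (from (iso (# 2) (# 1)) <-lit)
  no-top-τ₁ (_ ∷ _ ∷ _ ∷ _ ∷ []) (_ ∷ []) _ (_ ∷ _ ∷ _ ∷ x≤ ∷ _) _ (refl , iso) = top-maximal x≤ (from (iso (# 4) (# 3)) <-lit)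
  no-top-τ₁ (_ ∷ _ ∷ _ ∷ _ ∷ _ ∷ []) [] _ (_ ∷ _ ∷ _ ∷ x≤ ∷ _) _ (refl , iso) = top-maximal x≤ (from (iso (# 5) (# 3)) <-lit)
  no-top-τ₁ (_ ∷ _ ∷ _ ∷ _ ∷ _ ∷ _ ∷ []) _ _ _ _ (() , _)
  no-top-τ₁ (_ ∷ _ ∷ _ ∷ _ ∷ _ ∷ _ ∷ _ ∷ _) _ _ _ _ (() , _)

  no-top-τ₂ : NoTopOccurrence τ₂
  no-top-τ₂ [] (_ ∷ _ ∷ _ ∷ _ ∷ _ ∷ []) _ _ (_ ∷ _ ∷ _ ∷ y≤ ∷ _) (refl , iso) = top-maximal y≤ (from (iso (# 0) (# 4)) <-lit)
  no-top-τ₂ (_ ∷ []) (_ ∷ _ ∷ _ ∷ _ ∷ []) _ _ (_ ∷ _ ∷ y≤ ∷ _) (refl , iso) = top-maximal y≤ (from (iso (# 1) (# 4)) <-lit)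
  no-top-τ₂ (_ ∷ _ ∷ []) (_ ∷ _ ∷ _ ∷ []) _ _ (_ ∷ y≤ ∷ _) (refl , iso) = top-maximal y≤ (from (iso (# 2) (# 4)) <-lit)
  no-top-τ₂ (_ ∷ _ ∷ _ ∷ []) (_ ∷ _ ∷ []) _ _ (y≤ ∷ _) (refl , iso) = top-maximal y≤ (from (iso (# 3) (# 4)) <-lit)
  no-top-τ₂ (_ ∷ _ ∷ _ ∷ _ ∷ []) (_ ∷ []) ((x<y ∷ _) ∷ _) _ _ (refl , iso) = <-asym x<y (from (iso (# 1) (# 0)) <-lit)
  no-top-τ₂ (_ ∷ _ ∷ _ ∷ _ ∷ _ ∷ []) [] _ (_ ∷ _ ∷ _ ∷ _ ∷ x≤ ∷ _) _ (refl , iso) = top-maximal x≤ (from (iso (# 5) (# 4)) <-lit)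
  no-top-τ₂ (_ ∷ _ ∷ _ ∷ _ ∷ _ ∷ _ ∷ []) _ _ _ _ (() , _)
  no-top-τ₂ (_ ∷ _ ∷ _ ∷ _ ∷ _ ∷ _ ∷ _ ∷ _) _ _ _ _ (() , _)

  no-top-τ₃ : NoTopOccurrence τ₃
  no-top-τ₃ [] (_ ∷ _ ∷ _ ∷ _ ∷ _ ∷ []) _ _ (_ ∷ y≤ ∷ _) (refl , iso) = top-maximal y≤ (from (iso (# 0) (# 2)) <-lit)
  no-top-τ₃ (_ ∷ []) (_ ∷ _ ∷ _ ∷ _ ∷ []) _ _ (y≤ ∷ _) (refl , iso) = top-maximal y≤ (from (iso (# 1) (# 2)) <-lit)
  no-top-τ₃ (_ ∷ _ ∷ []) (_ ∷ _ ∷ _ ∷ []) ((x<y ∷ _) ∷ _) _ _ (refl , iso) = <-asym x<y (from (iso (# 1) (# 0)) <-lit)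
  no-top-τ₃ (_ ∷ _ ∷ _ ∷ []) (_ ∷ _ ∷ []) _ (_ ∷ _ ∷ x≤ ∷ _) _ (refl , iso) = top-maximal x≤ (from (iso (# 3) (# 2)) <-lit)
  no-top-τ₃ (_ ∷ _ ∷ _ ∷ _ ∷ []) (_ ∷ []) _ (_ ∷ _ ∷ x≤ ∷ _) _ (refl , iso) = top-maximal x≤ (from (iso (# 4) (# 2)) <-lit)
  no-top-τ₃ (_ ∷ _ ∷ _ ∷ _ ∷ _ ∷ []) [] _ (_ ∷ _ ∷ x≤ ∷ _) _ (refl , iso) = top-maximal x≤ (from (iso (# 5) (# 2)) <-lit)
  no-top-τ₃ (_ ∷ _ ∷ _ ∷ _ ∷ _ ∷ _ ∷ []) _ _ _ _ (() , _)
  no-top-τ₃ (_ ∷ _ ∷ _ ∷ _ ∷ _ ∷ _ ∷ _ ∷ _) _ _ _ _ (() , _)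

  no-top-τ : ∀ {τ} → τ ≡ τ₁ ⊎ τ ≡ τ₂ ⊎ τ ≡ τ₃ → NoTopOccurrence τ
  no-top-τ (inj₁ refl)        = no-top-τ₁
  no-top-τ (inj₂ (inj₁ refl)) = no-top-τ₂
  no-top-τ (inj₂ (inj₂ refl)) = no-top-τ₃

skewIns-avoids : ∀ m β i p → NoTopOccurrence m p → All (_≤ m) β → Increasing (take i β) →
                 Avoids β p → Avoids (skewIns i m β) p
skewIns-avoids m β i p no-top β≤m inc β-avoids (s , s⊆ , iso) with ⊆-++-∷⁻ (take i β) (drop i β) s⊆
... | inj₁ s⊆β rewrite take++drop≡id i β = β-avoids (s , s⊆β , iso)
... | inj₂ (s₁ , s₂ , refl , s₁⊆ , s₂⊆) =
  no-top s₁ s₂ (AllPairs-resp-⊆ s₁⊆ inc) (All-resp-⊆ s₁⊆ (take⁺ i β≤m))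
         (All-resp-⊆ s₂⊆ (drop⁺ i β≤m)) iso

lemma1 : (τ : List ℕ) → (τ ≡ τ₁ ⊎ τ ≡ τ₂ ⊎ τ ≡ τ₃) →
    (m : ℕ) (β : List ℕ) → InAv3 τ m β →
    (i : ℕ) → i ≤ ℓ β →
    InAv3 τ (suc m) (skewIns i m β)
lemma1 τ τ-cases m β (β-perm , β-2143 , β-3142 , β-τ) i i≤ℓ =
  skewIns-IsPerm m β i β-perm ,
  avoids _ (no-top-2143 m) β-2143 , avoids _ (no-top-3142 m) β-3142 , avoids τ (no-top-τ m τ-cases) β-τ
  where
  avoids : ∀ p → NoTopOccurrence m p → Avoids β p → Avoids (skewIns i m β) p
  avoids p no-top = skewIns-avoids m β i p no-top (IsPerm-bounded β-perm) (take-ℓ-increasing β i i≤ℓ)
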